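{- Let $n\ge 2$ and let $D_n=\langle a,b\mid a^n=e,\ b^2=e,\ bab^{ -1}=a^{ -1}\rangle$. Then the intersection hypergraph $\tilde{\Gamma}_\mathcal{H}(D_n)$ is connected and its diameter is at most $3$.
   Context: For a group $G$, let $S$ be the set of all non-trivial proper subgroups of $G$. The intersection hypergraph $\tilde{\Gamma}_\mathcal{H}(G)$ has vertex set $V=\{H\in S \mid H\cap K=\{e\}\text{ for some }K\in S\}$, and a subset $E\subseteq V$ is a hyperedge iff any two distinct members of $E$ intersect trivially and $E$ is maximal among subsets of $V$ with this property. A path in a hypergraph is an alternating vertex–hyperedge sequence $v_0E_1v_1E_2\cdots E_kv_k$ with $v_{i-1},v_i\in E_i$; its length is the number $k$ of hyperedges. A hypergraph is connected if any two vertices are joined by a path; the distance between two vertices is the minimum length of a path joining them, and the diameter is the maximum distance over all pairs of vertices. -}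

module Defs where

open import Level using (0ℓ)
open import Algebra.Bundles.Raw using (RawGroup)
open import Data.Bool using (Bool; true; false)
open import Data.Fin using (Fin; zero; toℕ)
open import Data.Nat using (ℕ; suc; _+_; _∸_; _≤_; NonZero)
open import Data.Nat.DivMod using (_mod_)
open import Data.Product using (_×_; Σ; ∃; _,_)
open import Data.Sum using (_⊎_)
open import Relation.Nullary using (¬_)
open import Relation.Binary.PropositionalEquality using (_≡_)

module Hyper (G : RawGroup 0ℓ 0ℓ) where
  open RawGroup G

  record Subgroup : Set where
    field
      mem     : Carrier → Bool
      resp    : ∀ {x y} → x ≈ y → mem x ≡ true → mem y ≡ true
      ε-mem   : mem ε ≡ true
      ∙-mem   : ∀ {x y} → mem x ≡ true → mem y ≡ true → mem (x ∙ y) ≡ true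
      ⁻¹-mem  : ∀ {x} → mem x ≡ true → mem (x ⁻¹) ≡ true

  open Subgroup public

  _∈_ : Carrier → Subgroup → Set
  x ∈ H = mem H x ≡ true

  _≐_ : Subgroup → Subgroup → Set
  H ≐ K = ∀ x → (x ∈ H → x ∈ K) × (x ∈ K → x ∈ H)

  TrivInt : Subgroup → Subgroup → Set
  TrivInt H K = ∀ x → x ∈ H → x ∈ K → x ≈ ε

  IsTrivial : Subgroup → Set
  IsTrivial H = ∀ x → x ∈ H → x ≈ ε

  IsProper : Subgroup → Set
  IsProper H = ¬ (∀ x → x ∈ H)

  InS : Subgroup → Set
  InS H = ¬ IsTrivial H × IsProper H

  IsVertex : Subgroup → Set
  IsVertex H = InS H × Σ Subgroup (λ K → InS K × TrivInt H K)

  Family : Set₁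
  Family = Subgroup → Set

  RespectsEq : Family → Set
  RespectsEq F = ∀ H K → H ≐ K → F H → F K

  ⊆V : Family → Set
  ⊆V F = ∀ H → F H → IsVertex H

  PairwiseTrivInt : Family → Set
  PairwiseTrivInt F = ∀ H K → F H → F K → ¬ (H ≐ K) → TrivInt H K

  IsHyperedge : Family → Set₁
  IsHyperedge E =
    RespectsEq E × ⊆V E × PairwiseTrivInt E ×
    (∀ (F : Family) → RespectsEq F → ⊆V F → PairwiseTrivInt F →
       (∀ H → E H → F H) → ∀ H → F H → E H)

  data Path : Subgroup → Subgroup → ℕ → Set₁ where
    nil  : ∀ {u v} → u ≐ v → Path u v 0
    cons : ∀ {u w v k} (E : Family) → IsHyperedge E → IsVertex u →
           E u → E w → Path w v k → Path u v (suc k)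

  Connected : Set₁
  Connected = ∀ u v → IsVertex u → IsVertex v → ∃ λ k → Path u v k

  DiamAtMost : ℕ → Set₁
  DiamAtMost d = ∀ u v → IsVertex u → IsVertex v →
                 ∃ λ k → k ≤ d × Path u v k

-- The dihedral group D_n = ⟨a, b | aⁿ = e, b² = e, bab⁻¹ = a⁻¹⟩ of order 2n.
-- (i , false) represents aⁱ and (i , true) represents aⁱ b.

_⊕_ : ∀ {n} → Fin n → Fin n → Fin n
_⊕_ {suc m} i j = (toℕ i + toℕ j) mod suc m

⊖_ : ∀ {n} → Fin n → Fin n
⊖_ {suc m} i = (suc m ∸ toℕ i) mod suc m

DihElem : ℕ → Set
DihElem n = Fin n × Bool

dihMul : ∀ {n} → DihElem n → DihElem n → DihElem n
dihMul (i , false) (j , false) = (i ⊕ j , false)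
dihMul (i , false) (j , true)  = (i ⊕ j , true)
dihMul (i , true)  (j , false) = (i ⊕ (⊖ j) , true)       -- aⁱb aʲ = aⁱ⁻ʲ b
dihMul (i , true)  (j , true)  = (i ⊕ (⊖ j) , false)      -- aⁱb aʲb = aⁱ⁻ʲ

dihInv : ∀ {n} → DihElem n → DihElem n
dihInv (i , false) = (⊖ i , false)
dihInv (i , true)  = (i , true)

Dih : (n : ℕ) → .{{NonZero n}} → RawGroup 0ℓ 0ℓ
Dih (suc m) = record
  { Carrier = DihElem (suc m)
  ; _≈_     = _≡_
  ; _∙_     = dihMul
  ; ε       = (zero , false)
  ; _⁻¹     = dihInv
  }

module Submission where

-- Every proper subgroup H of Dₙ misses some reflection aʳb (otherwise it would contain
-- aⁱ = aⁱb · b for all i), so H meets ⟨aʳb⟩ = {e, aʳb} trivially; in particular every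
-- subgroup in S is a vertex. Two reflection subgroups are equal or meet trivially, so any
-- vertices u, v are linked by u – ⟨aʳb⟩ – ⟨aˢb⟩ – v, each step being a pair of vertices
-- that are equal or meet trivially. In a finite group such a pair lies on a hyperedge:
-- extend it greedily over a list of all subgroups (enumerated by their membership tables).

open import Level using (0ℓ)
open import Algebra.Bundles.Raw using (RawGroup)
open import Data.Bool using (Bool; true; false)
import Data.Bool.Properties as Bool
open import Data.Fin using (Fin; zero; suc; toℕ; _↑ˡ_; _↑ʳ_; splitAt)
import Data.Fin.Properties as Fin
open import Data.Fin.Subset using (Subset)
open import Data.List using (List; []; _∷_; filter; mapMaybe; cartesianProductWith)
open import Data.List.Membership.Propositional using (_∈_; find; lose)
open import Data.List.Membership.Propositional.Properties using (∈-filter⁺; ∈-cartesianProductWith⁺)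
open import Data.List.Relation.Binary.Subset.Propositional using (_⊆_)
open import Data.List.Relation.Binary.Subset.Propositional.Properties using (Any-resp-⊆)
open import Data.List.Relation.Unary.All as All using (All; []; _∷_)
open import Data.List.Relation.Unary.All.Properties using (all-filter; ¬All⇒Any¬)
open import Data.List.Relation.Unary.AllPairs using (AllPairs; []; _∷_)
open import Data.List.Relation.Unary.Any as Any using (Any; here; there)
open import Data.List.Relation.Unary.Any.Properties using (mapMaybe⁺; map⁺)
open import Data.Maybe using (Maybe; just; nothing)
import Data.Maybe.Relation.Unary.Any as Maybe
open import Data.Nat using (ℕ; suc; _+_; _∸_; _%_; _≤_; s≤s; NonZero)
open import Data.Nat.DivMod using (_mod_; n%n≡0; m<n⇒m%n≡m; %-distribˡ-+; m%n%n≡m%n)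
open import Data.Nat.Properties using (≤-refl; +-identityʳ; m+[n∸m]≡n; <⇒≤)
open import Data.Product using (Σ; ∃; _×_; _,_; proj₁; proj₂; swap)
open import Data.Product.Properties using (≡-dec)
open import Data.Sum using (_⊎_; inj₁; inj₂; [_,_]′)
open import Data.Vec using ([]; _∷_; lookup; tabulate)
open import Data.Vec.Properties using (lookup∘tabulate)
open import Defs
open import Function using (_∘_; id)
open import Function.Bundles using (_↪_; mk↪; RightInverse)
open import Relation.Binary using (Rel; Decidable; Symmetric)
open import Relation.Binary.PropositionalEquality using (_≡_; refl; sym; trans; cong; subst; module ≡-Reasoning)
open import Relation.Nullary using (Dec; yes; no; ¬_; does; contradiction)
open import Relation.Nullary.Decidable using (_×-dec_; _⊎-dec_; _→-dec_; ¬?; map′; dec-true; decidable-stable)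
open import Relation.Unary using (Pred)

does⇒ : ∀ {p} {P : Set p} (P? : Dec P) → does P? ≡ true → P
does⇒ (yes p) _ = p

booleans : List Bool
booleans = true ∷ false ∷ []

∈-booleans : ∀ b → b ∈ booleans
∈-booleans true  = here refl
∈-booleans false = there (here refl)

allSubsets : (n : ℕ) → List (Subset n)
allSubsets ℕ.zero  = [] ∷ []
allSubsets (suc n) = cartesianProductWith _∷_ booleans (allSubsets n)

∈-allSubsets : ∀ {n} (p : Subset n) → p ∈ allSubsets n
∈-allSubsets []      = here refl
∈-allSubsets (b ∷ p) = ∈-cartesianProductWith⁺ _∷_ {xs = booleans} (∈-booleans b) (∈-allSubsets p)

AllPairs-∈⇒≡⊎ : ∀ {a r} {A : Set a} {R : Rel A r} → Symmetric R →
                ∀ {xs x y} → AllPairs R xs → x ∈ xs → y ∈ xs → x ≡ y ⊎ R x y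
AllPairs-∈⇒≡⊎ R-sym (Rx ∷ _)   (here refl) (here refl) = inj₁ refl
AllPairs-∈⇒≡⊎ R-sym (Rx ∷ _)   (here refl) (there y∈)  = inj₂ (All.lookup Rx y∈)
AllPairs-∈⇒≡⊎ R-sym (Rx ∷ _)   (there x∈)  (here refl) = inj₂ (R-sym (All.lookup Rx x∈))
AllPairs-∈⇒≡⊎ R-sym (_  ∷ Rxs) (there x∈)  (there y∈)  = AllPairs-∈⇒≡⊎ R-sym Rxs x∈ y∈

module Greedy {a r} {A : Set a} {R : Rel A r} (R? : Decidable R) where

  extend : List A → List A → List A
  extend acc []       = acc
  extend acc (c ∷ cs) with All.all? (R? c) acc
  ... | yes _ = extend (c ∷ acc) cs
  ... | no  _ = extend acc cs

  extend-⊇ : ∀ acc cs → acc ⊆ extend acc cs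
  extend-⊇ acc []       = id
  extend-⊇ acc (c ∷ cs) with All.all? (R? c) acc
  ... | yes _ = extend-⊇ (c ∷ acc) cs ∘ there
  ... | no  _ = extend-⊇ acc cs

  extend-All : ∀ {p} {P : Pred A p} {acc} cs → All P acc → All P cs → All P (extend acc cs)
  extend-All             []       Pacc []          = Pacc
  extend-All {acc = acc} (c ∷ cs) Pacc (Pc ∷ Pcs) with All.all? (R? c) acc
  ... | yes _ = extend-All cs (Pc ∷ Pacc) Pcs
  ... | no  _ = extend-All cs Pacc Pcs

  extend-AllPairs : ∀ {acc} cs → AllPairs R acc → AllPairs R (extend acc cs)
  extend-AllPairs             []       Racc = Racc
  extend-AllPairs {acc = acc} (c ∷ cs) Racc with All.all? (R? c) acc
  ... | yes Rc = extend-AllPairs cs (Rc ∷ Racc)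
  ... | no  _  = extend-AllPairs cs Racc

  extend-maximal : ∀ {c} acc cs → c ∈ cs → c ∈ extend acc cs ⊎ Any (¬_ ∘ R c) (extend acc cs)
  extend-maximal acc (c ∷ cs) (here refl) with All.all? (R? c) acc
  ... | yes _   = inj₁ (extend-⊇ (c ∷ acc) cs (here refl))
  ... | no  ¬Rc = inj₂ (Any-resp-⊆ (extend-⊇ acc cs) (¬All⇒Any¬ (R? c) acc ¬Rc))
  extend-maximal acc (c′ ∷ cs) (there c∈) with All.all? (R? c′) acc
  ... | yes _ = extend-maximal (c′ ∷ acc) cs c∈
  ... | no  _ = extend-maximal acc cs c∈

module SubgroupRelations (G : RawGroup 0ℓ 0ℓ) where
  open Hyper G renaming (_∈_ to _∈ᴴ_)

  ≐-refl : ∀ {H} → H ≐ H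
  ≐-refl x = id , id

  ≐-sym : ∀ {H K} → H ≐ K → K ≐ H
  ≐-sym H≐K x = swap (H≐K x)

  ≐-trans : ∀ {H K L} → H ≐ K → K ≐ L → H ≐ L
  ≐-trans H≐K K≐L x = proj₁ (K≐L x) ∘ proj₁ (H≐K x) , proj₂ (H≐K x) ∘ proj₂ (K≐L x)

  TrivInt-sym : ∀ {H K} → TrivInt H K → TrivInt K H
  TrivInt-sym H∩K x x∈K x∈H = H∩K x x∈H x∈K

  TrivInt-respˡ : ∀ {H H′ K} → H ≐ H′ → TrivInt H K → TrivInt H′ K
  TrivInt-respˡ H≐H′ H∩K x x∈H′ = H∩K x (proj₂ (H≐H′ x) x∈H′)

  TrivInt-respʳ : ∀ {H K K′} → K ≐ K′ → TrivInt H K → TrivInt H K′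
  TrivInt-respʳ K≐K′ H∩K x x∈H x∈K′ = H∩K x x∈H (proj₂ (K≐K′ x) x∈K′)

  InS-resp : ∀ {H K} → H ≐ K → InS H → InS K
  InS-resp H≐K (nontrivial , proper) =
    (λ K-trivial → nontrivial λ x → K-trivial x ∘ proj₁ (H≐K x)) ,
    (λ K-full → proper λ x → proj₂ (H≐K x) (K-full x))

  IsVertex-resp : ∀ {H K} → H ≐ K → IsVertex H → IsVertex K
  IsVertex-resp {H} {K} H≐K (H∈S , L , L∈S , H∩L) =
    InS-resp {H} {K} H≐K H∈S , L , L∈S , TrivInt-respˡ {H} {K} {L} H≐K H∩L

  Adjacent : Subgroup → Subgroup → Set
  Adjacent H K = H ≐ K ⊎ TrivInt H K

module FiniteGroup (G : RawGroup 0ℓ 0ℓ) (_≈?_ : Decidable (RawGroup._≈_ G))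
                   {m : ℕ} (finite : RawGroup.Carrier G ↪ Fin m) where
  open RawGroup G
  open Hyper G renaming (_∈_ to _∈ᴴ_)
  open SubgroupRelations G
  open RightInverse finite using (to; from; strictlyInverseʳ)

  ∀? : ∀ {p} {P : Pred Carrier p} → (∀ x → Dec (P x)) → Dec (∀ x → P x)
  ∀? {P = P} P? = map′ (λ ∀P x → subst P (strictlyInverseʳ x) (∀P (to x)))
                       (λ ∀P i → ∀P (from i))
                       (Fin.all? (P? ∘ from))

  _∈ᴴ?_ : ∀ x H → Dec (x ∈ᴴ H)
  x ∈ᴴ? H = mem H x Bool.≟ true

  IsTrivial? : ∀ H → Dec (IsTrivial H)
  IsTrivial? H = ∀? λ x → (x ∈ᴴ? H) →-dec (x ≈? ε)

  IsProper? : ∀ H → Dec (IsProper H)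
  IsProper? H = ¬? (∀? (_∈ᴴ? H))

  InS? : ∀ H → Dec (InS H)
  InS? H = ¬? (IsTrivial? H) ×-dec IsProper? H

  TrivInt? : ∀ H K → Dec (TrivInt H K)
  TrivInt? H K = ∀? λ x → (x ∈ᴴ? H) →-dec (x ∈ᴴ? K) →-dec (x ≈? ε)

  ≐? : ∀ H K → Dec (H ≐ K)
  ≐? H K = ∀? λ x → ((x ∈ᴴ? H) →-dec (x ∈ᴴ? K)) ×-dec ((x ∈ᴴ? K) →-dec (x ∈ᴴ? H))

  SubgroupLaws : (Carrier → Bool) → Set
  SubgroupLaws s =
    (∀ x y → x ≈ y → s x ≡ true → s y ≡ true) × s ε ≡ true ×
    (∀ x y → s x ≡ true → s y ≡ true → s (x ∙ y) ≡ true) × (∀ x → s x ≡ true → s (x ⁻¹) ≡ true)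

  SubgroupLaws? : ∀ s → Dec (SubgroupLaws s)
  SubgroupLaws? s =
    ∀? (λ x → ∀? λ y → (x ≈? y) →-dec (s x Bool.≟ true) →-dec (s y Bool.≟ true)) ×-dec
    (s ε Bool.≟ true) ×-dec
    ∀? (λ x → ∀? λ y → (s x Bool.≟ true) →-dec (s y Bool.≟ true) →-dec (s (x ∙ y) Bool.≟ true)) ×-dec
    ∀? (λ x → (s x Bool.≟ true) →-dec (s (x ⁻¹) Bool.≟ true))

  ≗mem⇒SubgroupLaws : ∀ H {s} → (∀ x → s x ≡ mem H x) → SubgroupLaws s
  ≗mem⇒SubgroupLaws H {s} s≗H =
    (λ x y x≈y → into ∘ resp H x≈y ∘ out) , into (ε-mem H) ,
    (λ x y sx sy → into (∙-mem H (out sx) (out sy))) , (λ x → into ∘ ⁻¹-mem H ∘ out)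
    where
      out : ∀ {x} → s x ≡ true → x ∈ᴴ H
      out {x} = trans (sym (s≗H x))
      into : ∀ {x} → x ∈ᴴ H → s x ≡ true
      into {x} = trans (s≗H x)

  subgroup : ∀ s → SubgroupLaws s → Subgroup
  subgroup s (s-resp , s-ε , s-∙ , s-⁻¹) = record
    { mem    = s
    ; resp   = s-resp _ _
    ; ε-mem  = s-ε
    ; ∙-mem  = s-∙ _ _
    ; ⁻¹-mem = s-⁻¹ _
    }

  subgroup? : (Carrier → Bool) → Maybe Subgroup
  subgroup? s with SubgroupLaws? s
  ... | yes laws = just (subgroup s laws)
  ... | no  _    = nothing

  subgroups : List Subgroup
  subgroups = mapMaybe (λ p → subgroup? (lookup p ∘ to)) (allSubsets m)

  subgroups-complete : ∀ H → Any (H ≐_) subgroups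
  subgroups-complete H = mapMaybe⁺ _ (allSubsets m) (map⁺ (lose (∈-allSubsets pH) found))
    where
      pH : Subset m
      pH = tabulate (mem H ∘ from)
      pH≗H : ∀ x → lookup pH (to x) ≡ mem H x
      pH≗H x = trans (lookup∘tabulate (mem H ∘ from) (to x)) (cong (mem H) (strictlyInverseʳ x))
      found : Maybe.Any (H ≐_) (subgroup? (lookup pH ∘ to))
      found with SubgroupLaws? (lookup pH ∘ to)
      ... | yes _     = Maybe.just λ x → trans (pH≗H x) , trans (sym (pH≗H x))
      ... | no  ¬laws = contradiction (≗mem⇒SubgroupLaws H pH≗H) ¬laws

  IsVertex? : ∀ H → Dec (IsVertex H)
  IsVertex? H = InS? H ×-dec map′ Any.satisfied partner∈subgroups
                                  (Any.any? (λ K → InS? K ×-dec TrivInt? H K) subgroups)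
    where
      partner∈subgroups : Σ Subgroup (λ K → InS K × TrivInt H K) →
                          Any (λ K → InS K × TrivInt H K) subgroups
      partner∈subgroups (K , K∈S , H∩K) =
        Any.map (λ {K′} K≐K′ → InS-resp {K} {K′} K≐K′ K∈S , TrivInt-respʳ {H} {K} {K′} K≐K′ H∩K)
                (subgroups-complete K)

  module GreedyHyperedge {Hs : List Subgroup} (Hs-vertices : All IsVertex Hs)
                         (Hs-disjoint : AllPairs TrivInt Hs) where
    open Greedy TrivInt?

    candidates : List Subgroup
    candidates = filter IsVertex? subgroups

    members : List Subgroup
    members = extend Hs candidates

    members-vertices : All IsVertex members
    members-vertices = extend-All candidates Hs-vertices (all-filter IsVertex? subgroups)

    Hs⊆members : Hs ⊆ members
    Hs⊆members = extend-⊇ Hs candidates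

    members-disjoint : AllPairs TrivInt members
    members-disjoint = extend-AllPairs candidates Hs-disjoint

    E : Family
    E H = Any (H ≐_) members

    ∈members⇒E : ∀ {H} → H ∈ members → E H
    ∈members⇒E {H} = Any.map λ { refl → ≐-refl {H} }

    E-respects : RespectsEq E
    E-respects H K H≐K = Any.map λ {L} → ≐-trans {K} {H} {L} (≐-sym {H} {K} H≐K)

    E⊆V : ⊆V E
    E⊆V H EH with find EH
    ... | K , K∈ , H≐K = IsVertex-resp {K} {H} (≐-sym {H} {K} H≐K)
                           (All.lookup members-vertices K∈)

    E-pairwise : PairwiseTrivInt E
    E-pairwise H K EH EK H≉K with find EH | find EK
    ... | H′ , H′∈ , H≐H′ | K′ , K′∈ , K≐K′
      with AllPairs-∈⇒≡⊎ (λ {H K} → TrivInt-sym {H} {K}) members-disjoint H′∈ K′∈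
    ... | inj₁ refl = contradiction (≐-trans {H} {H′} {K} H≐H′ (≐-sym {K} {H′} K≐K′)) H≉K
    ... | inj₂ H′∩K′ = TrivInt-respˡ {H′} {H} {K} (≐-sym {H} {H′} H≐H′)
                         (TrivInt-respʳ {H′} {K′} {K} (≐-sym {K} {K′} K≐K′) H′∩K′)

    -- H ∈ F is ≐ to a listed candidate K. Either K was kept, or K meets a kept L
    -- nontrivially; as L ∈ F as well, pairwise disjointness of F forces H ≐ L.
    E-maximal : ∀ F → RespectsEq F → ⊆V F → PairwiseTrivInt F →
                (∀ H → E H → F H) → ∀ H → F H → E H
    E-maximal F _ F⊆V F-pairwise E⊆F H FH with find (subgroups-complete H)
    ... | K , K∈ , H≐K
      with extend-maximal Hs candidates (∈-filter⁺ IsVertex? K∈ (IsVertex-resp {H} {K} H≐K (F⊆V H FH)))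
    ... | inj₁ K∈members = E-respects K H (≐-sym {H} {K} H≐K) (∈members⇒E K∈members)
    ... | inj₂ K-meets with find K-meets
    ... | L , L∈ , K∩L≢ε = E-respects L H (≐-sym {H} {L} H≐L) (∈members⇒E L∈)
      where
        H≐L : H ≐ L
        H≐L = decidable-stable (≐? H L) λ H≉L →
          K∩L≢ε (TrivInt-respˡ {H} {K} {L} H≐K (F-pairwise H L FH (E⊆F L (∈members⇒E L∈)) H≉L))

  hyperedge-through : ∀ {Hs} → All IsVertex Hs → AllPairs TrivInt Hs →
                      Σ Family λ E → IsHyperedge E × All E Hs
  hyperedge-through {Hs} Hs-vertices Hs-disjoint =
    E , (E-respects , E⊆V , E-pairwise , E-maximal) ,
    All.tabulate (∈members⇒E ∘ Hs⊆members)
    where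
      open GreedyHyperedge Hs-vertices Hs-disjoint

  hyperedge-through-adjacent : ∀ {H K} → IsVertex H → IsVertex K → Adjacent H K →
                               Σ Family λ E → IsHyperedge E × E H × E K
  hyperedge-through-adjacent {H} {K} H∈V K∈V (inj₁ H≐K)
    with hyperedge-through (H∈V ∷ []) ([] ∷ [])
  ... | E , E-hyperedge , EH ∷ [] = E , E-hyperedge , EH , proj₁ E-hyperedge H K H≐K EH
  hyperedge-through-adjacent H∈V K∈V (inj₂ H∩K)
    with hyperedge-through (H∈V ∷ K∈V ∷ []) ((H∩K ∷ []) ∷ [] ∷ [])
  ... | E , E-hyperedge , EH ∷ EK ∷ [] = E , E-hyperedge , EH , EK

  path-cons : ∀ {u w v k} → IsVertex u → IsVertex w → Adjacent u w → Path w v k → Path u v (suc k)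
  path-cons u∈V w∈V u~w w⇝v with hyperedge-through-adjacent u∈V w∈V u~w
  ... | E , E-hyperedge , Eu , Ew = cons E E-hyperedge u∈V Eu Ew w⇝v

module _ {m : ℕ} where
  private
    n = suc m

  toℕ-mod : ∀ a → toℕ (a mod n) ≡ a % n
  toℕ-mod a = Fin.toℕ-fromℕ< _

  mod-toℕ : (i : Fin n) → toℕ i mod n ≡ i
  mod-toℕ i = Fin.toℕ-injective (trans (toℕ-mod (toℕ i)) (m<n⇒m%n≡m (Fin.toℕ<n i)))

  ⊖-zero : ⊖_ {n} zero ≡ zero
  ⊖-zero = Fin.toℕ-injective (trans (toℕ-mod n) (n%n≡0 n))

  ⊕-identityˡ : (i : Fin n) → zero ⊕ i ≡ i
  ⊕-identityˡ = mod-toℕ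

  ⊕-identityʳ : (i : Fin n) → i ⊕ zero ≡ i
  ⊕-identityʳ i = trans (cong (_mod n) (+-identityʳ (toℕ i))) (mod-toℕ i)

  ⊕-⊖-zero : (i : Fin n) → i ⊕ (⊖ zero) ≡ i
  ⊕-⊖-zero i = trans (cong (i ⊕_) ⊖-zero) (⊕-identityʳ i)

  ⊕-inverseʳ : (i : Fin n) → i ⊕ (⊖ i) ≡ zero
  ⊕-inverseʳ i = Fin.toℕ-injective (begin
    toℕ (i ⊕ (⊖ i))                ≡⟨ toℕ-mod (a + toℕ (⊖ i)) ⟩
    (a + toℕ (⊖ i)) % n            ≡⟨ cong (λ z → (a + z) % n) (toℕ-mod b) ⟩
    (a + b % n) % n                ≡⟨ %-distribˡ-+ a (b % n) n ⟩
    (a % n + b % n % n) % n        ≡⟨ cong (λ z → (a % n + z) % n) (m%n%n≡m%n b n) ⟩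
    (a % n + b % n) % n            ≡⟨ %-distribˡ-+ a b n ⟨
    (a + b) % n                    ≡⟨ cong (_% n) (m+[n∸m]≡n (<⇒≤ (Fin.toℕ<n i))) ⟩
    n % n                          ≡⟨ n%n≡0 n ⟩
    0                              ∎)
    where
      open ≡-Reasoning
      a = toℕ i
      b = n ∸ toℕ i

DihElem↪Fin : ∀ {n} → DihElem n ↪ Fin (n + n)
DihElem↪Fin {n} = mk↪ {to = to} {from = from} λ { refl → from∘to _ }
  where
    to : DihElem n → Fin (n + n)
    to (i , false) = i ↑ˡ n
    to (i , true)  = n ↑ʳ i
    from : Fin (n + n) → DihElem n
    from k = [ (_, false) , (_, true) ]′ (splitAt n k)
    from∘to : ∀ x → from (to x) ≡ x
    from∘to (i , false) = cong [ (_, false) , (_, true) ]′ (Fin.splitAt-↑ˡ n i n)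
    from∘to (i , true)  = cong [ (_, false) , (_, true) ]′ (Fin.splitAt-↑ʳ n n i)

module Dihedral (k : ℕ) where
  N : ℕ
  N = suc (suc k)

  open Hyper (Dih N) renaming (_∈_ to _∈ᴴ_)
  open SubgroupRelations (Dih N)
  open FiniteGroup (Dih N) (≡-dec Fin._≟_ Bool._≟_) DihElem↪Fin

  e : DihElem N
  e = (zero , false)

  reflection : Fin N → DihElem N
  reflection r = (r , true)

  _∈⟨_⟩ : DihElem N → DihElem N → Set
  x ∈⟨ s ⟩ = x ≡ e ⊎ x ≡ s

  _∈⟨_⟩? : ∀ x s → Dec (x ∈⟨ s ⟩)
  x ∈⟨ s ⟩? = ≡-dec Fin._≟_ Bool._≟_ x e ⊎-dec ≡-dec Fin._≟_ Bool._≟_ x s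

  ∈⟨reflection⟩-∙ : ∀ {r x y} → x ∈⟨ reflection r ⟩ → y ∈⟨ reflection r ⟩ →
                    dihMul x y ∈⟨ reflection r ⟩
  ∈⟨reflection⟩-∙       (inj₁ refl) (inj₁ refl) = inj₁ (cong (_, false) (⊕-identityˡ zero))
  ∈⟨reflection⟩-∙ {r}   (inj₁ refl) (inj₂ refl) = inj₂ (cong (_, true) (⊕-identityˡ r))
  ∈⟨reflection⟩-∙ {r}   (inj₂ refl) (inj₁ refl) = inj₂ (cong (_, true) (⊕-⊖-zero r))
  ∈⟨reflection⟩-∙ {r}   (inj₂ refl) (inj₂ refl) = inj₁ (cong (_, false) (⊕-inverseʳ r))

  ∈⟨reflection⟩-⁻¹ : ∀ {r x} → x ∈⟨ reflection r ⟩ → dihInv x ∈⟨ reflection r ⟩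
  ∈⟨reflection⟩-⁻¹ (inj₁ refl) = inj₁ (cong (_, false) ⊖-zero)
  ∈⟨reflection⟩-⁻¹ (inj₂ refl) = inj₂ refl

  ⟨reflection_⟩ : Fin N → Subgroup
  ⟨reflection r ⟩ = record
    { mem    = λ x → does (x ∈⟨ reflection r ⟩?)
    ; resp   = λ { refl → id }
    ; ε-mem  = dec-true (e ∈⟨ reflection r ⟩?) (inj₁ refl)
    ; ∙-mem  = λ {x} {y} x∈ y∈ → dec-true (dihMul x y ∈⟨ reflection r ⟩?)
                 (∈⟨reflection⟩-∙ (does⇒ (x ∈⟨ reflection r ⟩?) x∈) (does⇒ (y ∈⟨ reflection r ⟩?) y∈))
    ; ⁻¹-mem = λ {x} x∈ → dec-true (dihInv x ∈⟨ reflection r ⟩?)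
                 (∈⟨reflection⟩-⁻¹ (does⇒ (x ∈⟨ reflection r ⟩?) x∈))
    }

  ∈ᴴ⟨reflection⟩⇒ : ∀ {r x} → x ∈ᴴ ⟨reflection r ⟩ → x ∈⟨ reflection r ⟩
  ∈ᴴ⟨reflection⟩⇒ {r} {x} = does⇒ (x ∈⟨ reflection r ⟩?)

  ⟨reflection⟩∈S : ∀ r → InS ⟨reflection r ⟩
  ⟨reflection⟩∈S r = nontrivial , proper
    where
      nontrivial : ¬ IsTrivial ⟨reflection r ⟩
      nontrivial trivial with trivial (reflection r) (dec-true (reflection r ∈⟨ reflection r ⟩?) (inj₂ refl))
      ... | ()
      -- The rotation a = (suc zero , false) is missing; this is where n ≥ 2 is used.
      proper : IsProper ⟨reflection r ⟩
      proper full with ∈ᴴ⟨reflection⟩⇒ {r} {suc zero , false} (full (suc zero , false))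
      ... | inj₁ ()
      ... | inj₂ ()

  TrivInt-⟨reflection⟩ : ∀ {H r} → ¬ reflection r ∈ᴴ H → TrivInt H ⟨reflection r ⟩
  TrivInt-⟨reflection⟩ {r = r} r∉H x x∈H x∈⟨r⟩ with ∈ᴴ⟨reflection⟩⇒ {r} {x} x∈⟨r⟩
  ... | inj₁ refl = refl
  ... | inj₂ refl = contradiction x∈H r∉H

  proper⇒∃reflection∉ : ∀ {H} → IsProper H → ∃ λ r → ¬ reflection r ∈ᴴ H
  proper⇒∃reflection∉ {H} H-proper =
    Fin.¬∀⟶∃¬ N _ (λ r → reflection r ∈ᴴ? H) λ reflections∈H → H-proper λ where
      (i , true)  → reflections∈H i
      (i , false) → subst (_∈ᴴ H) (cong (_, false) (⊕-⊖-zero i))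
                          (∙-mem H (reflections∈H i) (reflections∈H zero))

  InS⇒IsVertex : ∀ {H} → InS H → IsVertex H
  InS⇒IsVertex {H} H∈S with proper⇒∃reflection∉ {H} (proj₂ H∈S)
  ... | r , r∉H = H∈S , ⟨reflection r ⟩ , ⟨reflection⟩∈S r , TrivInt-⟨reflection⟩ {H} r∉H

  ⟨reflection⟩∈V : ∀ r → IsVertex ⟨reflection r ⟩
  ⟨reflection⟩∈V r = InS⇒IsVertex {⟨reflection r ⟩} (⟨reflection⟩∈S r)

  ⟨reflection⟩-adjacent : ∀ r s → Adjacent ⟨reflection r ⟩ ⟨reflection s ⟩
  ⟨reflection⟩-adjacent r s with r Fin.≟ s
  ... | yes refl = inj₁ (≐-refl {⟨reflection r ⟩})
  ... | no  r≢s  = inj₂ (TrivInt-⟨reflection⟩ {⟨reflection r ⟩} λ s∈⟨r⟩ →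
                     [ (λ ()) , (λ { refl → r≢s refl }) ]′ (∈ᴴ⟨reflection⟩⇒ {r} {reflection s} s∈⟨r⟩))

  path-of-length-3 : ∀ {u v} → IsVertex u → IsVertex v → Path u v 3
  path-of-length-3 {u} {v} u∈V v∈V
    with proper⇒∃reflection∉ {u} (proj₂ (proj₁ u∈V)) | proper⇒∃reflection∉ {v} (proj₂ (proj₁ v∈V))
  ... | r , r∉u | s , s∉v =
    path-cons {u} {⟨reflection r ⟩} u∈V (⟨reflection⟩∈V r)
      (inj₂ (TrivInt-⟨reflection⟩ {u} r∉u))
    (path-cons {⟨reflection r ⟩} {⟨reflection s ⟩} (⟨reflection⟩∈V r) (⟨reflection⟩∈V s)
      (⟨reflection⟩-adjacent r s)
    (path-cons {⟨reflection s ⟩} {v} (⟨reflection⟩∈V s) v∈V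
      (inj₂ (TrivInt-sym {v} {⟨reflection s ⟩} (TrivInt-⟨reflection⟩ {v} s∉v)))
    (nil (≐-refl {v}))))

mainTheorem2 : (n : ℕ) .{{_ : NonZero n}} → 2 ≤ n →
    Hyper.Connected (Dih n) × Hyper.DiamAtMost (Dih n) 3
mainTheorem2 (suc (suc k)) _ =
  (λ u v u∈V v∈V → 3 , path-of-length-3 u∈V v∈V) ,
  (λ u v u∈V v∈V → 3 , ≤-refl , path-of-length-3 u∈V v∈V)
  where open Dihedral k
mainTheorem2 (suc ℕ.zero) (s≤s ())
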